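{- Let $w\in S_n$ and let $c=(c_1,\dots,c_n)$ be its Lehmer code. Then $w$ avoids the patterns $3142$, $3214$, $2431$ and $3241$ (equivalently, $w^{ -1}$ is evil-avoiding) if and only if the following holds: for each position $j$ with $w_j>w_{j+1}$, if there exists $b\le j$ such that $w_b<w_{b+1}<\cdots<w_j$ and $0<c_b<n-j$, and $b$ is chosen maximal with these properties, then $c_{j+1}=c_{j+2}=\cdots=c_{j+c_b}=0$.
   Context: Lehmer code: $c_i=|\{j>i: w_j<w_i\}|$. A permutation is evil-avoiding if it avoids $2413,4132,4213,3214$. -}

module Defs where

open import Data.Nat using (ℕ; zero; suc; _<_; _≤_; _∸_; _+_)
open import Data.Fin using (Fin; toℕ)
import Data.Fin as Fin
open import Relation.Binary.PropositionalEquality using (_≡_)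
open import Data.Fin.Permutation using (Permutation′; _⟨$⟩ʳ_)
open import Data.List using (List; []; _∷_; length; filter)
open import Data.List.Base using (allFin)
open import Data.Product using (Σ; _×_; _,_)
open import Relation.Nullary using (¬_)
open import Relation.Nullary.Decidable using (_×-dec_)
import Data.Nat.Properties as ℕP
open import Function.Bundles using (_⇔_)

-- Positions and values are 0-based: w i is toℕ (w ⟨$⟩ʳ i) ∈ {0,…,n-1}
-- (a shift of the paper's 1-based convention; relative order is unchanged).
val : ∀ {n} → Permutation′ n → Fin n → ℕ
val w i = toℕ (w ⟨$⟩ʳ i)

lehmer : ∀ {n} → Permutation′ n → Fin n → ℕ
lehmer {n} w i =
  length (filter (λ j → (toℕ i ℕP.<? toℕ j) ×-dec (val w j ℕP.<? val w i)) (allFin n))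

-- A pattern of length 4, given by its one-line notation (values 1..4).
Pattern4 : Set
Pattern4 = Fin 4 → ℕ

Contains : ∀ {n} → Permutation′ n → Pattern4 → Set
Contains {n} w p =
  Σ (Fin 4 → Fin n) λ f →
    (∀ a b → toℕ a < toℕ b → toℕ (f a) < toℕ (f b)) ×
    (∀ a b → (p a < p b) ⇔ (val w (f a) < val w (f b)))

Avoids : ∀ {n} → Permutation′ n → Pattern4 → Set
Avoids w p = ¬ Contains w p

p3142 p3214 p2431 p3241 : Pattern4
p3142 Fin.zero = 3
p3142 (Fin.suc Fin.zero) = 1
p3142 (Fin.suc (Fin.suc Fin.zero)) = 4
p3142 (Fin.suc (Fin.suc (Fin.suc Fin.zero))) = 2
p3214 Fin.zero = 3
p3214 (Fin.suc Fin.zero) = 2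
p3214 (Fin.suc (Fin.suc Fin.zero)) = 1
p3214 (Fin.suc (Fin.suc (Fin.suc Fin.zero))) = 4
p2431 Fin.zero = 2
p2431 (Fin.suc Fin.zero) = 4
p2431 (Fin.suc (Fin.suc Fin.zero)) = 3
p2431 (Fin.suc (Fin.suc (Fin.suc Fin.zero))) = 1
p3241 Fin.zero = 3
p3241 (Fin.suc Fin.zero) = 2
p3241 (Fin.suc (Fin.suc Fin.zero)) = 4
p3241 (Fin.suc (Fin.suc (Fin.suc Fin.zero))) = 1

-- Candidate b for descent position j (0-based; paper's j is toℕ j + 1):
-- b ≤ j, w_b < w_{b+1} < ⋯ < w_j, and 0 < c_b < n - (paper's j).
Candidate : ∀ {n} → Permutation′ n → (j b : Fin n) → Set
Candidate {n} w j b =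
  (toℕ b ≤ toℕ j) ×
  (∀ (k l : Fin n) → toℕ b ≤ toℕ k → toℕ k < toℕ l → toℕ l ≤ toℕ j →
     val w k < val w l) ×
  (0 < lehmer w b) ×
  (lehmer w b < n ∸ suc (toℕ j))

LehmerCondition : ∀ {n} → Permutation′ n → Set
LehmerCondition {n} w =
  ∀ (j j′ : Fin n) → toℕ j′ ≡ suc (toℕ j) → val w j′ < val w j →
  ∀ (b : Fin n) → Candidate w j b →
  (∀ (b′ : Fin n) → toℕ b < toℕ b′ → ¬ Candidate w j b′) →
  ∀ (k : Fin n) → toℕ j < toℕ k → toℕ k ≤ toℕ j + lehmer w b → lehmer w k ≡ 0

module Submission where

-- Fix a descent w_j > w_{j+1} ending an increasing run w_b < ⋯ < w_j. Every inversion (b, i)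
-- has i > j, so c_b counts the values below w_b among the n - j - 1 positions after j: hence
-- c_b < n - j - 1 iff some later value exceeds w_b, and comparing c_b with the size of the window
-- j < k ≤ j + c_b locates values above and below w_b inside and beyond the window.
--
-- If the four patterns are avoided and c_k > 0 for some k in the window of the maximal candidate b,
-- take m > k with w_m < w_k. When w_k > w_b the window count gives a later s with w_s < w_b; when
-- w_k < w_b there is a later t with w_t > w_b, and if b < j, maximality of b (applied to b + 1)
-- forces w_t < w_j. In each case the values at b, j, j + 1, k, s, t, m exhibit one of the patterns.
--
-- Conversely, each pattern starts with an inversion at some p; let j end the run from p. The pattern
-- supplies a value beyond j above w_p, so c_p < n - j - 1, and an inversion (y, z) beyond j with
-- w_z < w_p. For the maximal candidate b ≥ p, either y lies in the window of b, or the window holds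
-- some k with w_k > w_b > w_z; either way a code in the window is positive, contradicting the
-- condition.

open import Defs
open import Data.Nat using (ℕ; zero; suc; pred; _<_; _≤_; _∸_; _+_; z≤n; s≤s; _≤?_; _<?_; _≟_)
open import Data.Nat.Properties
open import Data.Fin using (Fin; toℕ; inject₁; fromℕ<; #_)
import Data.Fin as F
open import Data.Fin.Properties using (all?; any?; toℕ<n; toℕ-fromℕ<; toℕ-injective)
open import Data.Fin.Induction using (>-wellFounded)
open import Data.Fin.Permutation using (Permutation′)
open import Data.List using (List; []; _∷_; length; filter; map; tabulate; allFin)
open import Data.List.Properties using (map-tabulate; filter-some; filter-none; filter-≐)
open import Data.List.Membership.Propositional using (_∈_)
open import Data.List.Relation.Unary.Any using (here; there)
import Data.List.Relation.Unary.Any.Properties as Any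
import Data.List.Relation.Unary.All.Properties as All
open import Data.Vec using (Vec; _∷_; []; lookup)
open import Data.Product using (Σ; ∃; _×_; _,_)
open import Data.Sum using (_⊎_; inj₁; inj₂; [_,_]′)
open import Data.Empty using (⊥; ⊥-elim)
open import Function using (_∘_; id)
open import Function.Bundles using (_⇔_; mk⇔; Equivalence; Injection)
open import Function.Properties.Inverse using (↔⇒↣)
open import Induction.WellFounded using (Acc; acc)
open import Level using (Level)
open import Relation.Binary.Definitions using (tri<; tri≈; tri>)
open import Relation.Binary.PropositionalEquality
open import Relation.Nullary using (¬_; yes; no; contradiction)
open import Relation.Nullary.Decidable using (_×-dec_; True; toWitness)
open import Relation.Unary using (Pred; Decidable; _⊆_; _≐_)

private variable
  a ℓ ℓ′ : Level
  A B : Set a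

module _ {P : Pred A ℓ} {Q : Pred A ℓ′} (P? : Decidable P) (Q? : Decidable Q) (P⊆Q : P ⊆ Q) where

  length-filter-mono : ∀ xs → length (filter P? xs) ≤ length (filter Q? xs)
  length-filter-mono []       = z≤n
  length-filter-mono (x ∷ xs) with P? x | Q? x
  ... | yes _  | yes _  = s≤s (length-filter-mono xs)
  ... | yes px | no ¬qx = contradiction (P⊆Q px) ¬qx
  ... | no _   | yes _  = m≤n⇒m≤1+n (length-filter-mono xs)
  ... | no _   | no _   = length-filter-mono xs

  length-filter-mono-< : ∀ {x xs} → x ∈ xs → Q x → ¬ P x →
                         length (filter P? xs) < length (filter Q? xs)
  length-filter-mono-< {xs = y ∷ xs} x∈ qx ¬px with P? y | Q? y | x∈
  ... | yes py | _      | here refl = contradiction py ¬px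
  ... | no _   | no ¬qy | here refl = contradiction qx ¬qy
  ... | no _   | yes _  | here refl = s≤s (length-filter-mono xs)
  ... | yes py | no ¬qy | there _   = contradiction (P⊆Q py) ¬qy
  ... | yes _  | yes _  | there x∈xs = s≤s (length-filter-mono-< x∈xs qx ¬px)
  ... | no _   | yes _  | there x∈xs = m≤n⇒m≤1+n (length-filter-mono-< x∈xs qx ¬px)
  ... | no _   | no _   | there x∈xs = length-filter-mono-< x∈xs qx ¬px

length-filter-map : {P : Pred B ℓ} (P? : Decidable P) (f : A → B) (xs : List A) →
                    length (filter P? (map f xs)) ≡ length (filter (P? ∘ f) xs)
length-filter-map P? f []       = refl
length-filter-map P? f (x ∷ xs) with P? (f x)
... | yes _ = cong suc (length-filter-map P? f xs)
... | no _  = length-filter-map P? f xs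

count : ∀ {n} {P : Pred (Fin n) ℓ} → Decidable P → ℕ
count {n = n} P? = length (filter P? (allFin n))

module _ {n} {P : Pred (Fin n) ℓ} (P? : Decidable P) where

  count-mono : {Q : Pred (Fin n) ℓ′} (Q? : Decidable Q) → P ⊆ Q → count P? ≤ count Q?
  count-mono Q? P⊆Q = length-filter-mono P? Q? P⊆Q (allFin n)

  count-mono-< : {Q : Pred (Fin n) ℓ′} (Q? : Decidable Q) → P ⊆ Q →
                 ∀ {i} → Q i → ¬ P i → count P? < count Q?
  count-mono-< Q? P⊆Q {i} = length-filter-mono-< P? Q? P⊆Q (Any.tabulate⁺ i refl)

  count-cong : {Q : Pred (Fin n) ℓ′} (Q? : Decidable Q) → P ≐ Q → count P? ≡ count Q?
  count-cong Q? P≐Q = cong length (filter-≐ P? Q? P≐Q (allFin n))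

  count-pos : ∀ {i} → P i → 0 < count P?
  count-pos {i} pi = filter-some P? (Any.tabulate⁺ i pi)

  count-none : (∀ i → ¬ P i) → count P? ≡ 0
  count-none ¬p = cong length (filter-none P? (All.tabulate⁺ ¬p))

  count-pos⇒∃ : 0 < count P? → ∃ P
  count-pos⇒∃ pos with any? P?
  ... | yes ∃p = ∃p
  ... | no ¬∃p = contradiction (count-none λ i pi → ¬∃p (i , pi))
                               (>⇒≢ pos)

count-tail : ∀ {n} {P : Pred (Fin (suc n)) ℓ} (P? : Decidable P) →
             length (filter P? (tabulate F.suc)) ≡ count (P? ∘ F.suc)
count-tail {n = n} P? = trans (cong (length ∘ filter P?) (sym (map-tabulate id F.suc)))
                              (length-filter-map P? F.suc (allFin n))

Interval : ∀ {n} (a e : ℕ) → Pred (Fin n) _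
Interval a e i = a ≤ toℕ i × toℕ i < e

Interval? : ∀ {n} (a e : ℕ) → Decidable (Interval {n} a e)
Interval? a e i = (a ≤? toℕ i) ×-dec (toℕ i <? e)

interval-shift : ∀ {n} a {e} → Interval {suc n} a (suc e) ∘ F.suc ≐ Interval (pred a) e
interval-shift zero    = (λ { (_ , s≤s i<e) → z≤n , i<e }) , λ (_ , i<e) → z≤n , s≤s i<e
interval-shift (suc a) = (λ { (s≤s a≤i , s≤s i<e) → a≤i , i<e }) , λ (a≤i , i<e) → s≤s a≤i , s≤s i<e

count-interval : ∀ {n} a e → e ≤ n → count (Interval? {n} a e) ≡ e ∸ a
count-interval-tail : ∀ {n} a e → e ≤ n →
                      length (filter (Interval? {suc n} a (suc e)) (tabulate F.suc)) ≡ e ∸ pred a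

count-interval {n} a zero _ =
  trans (count-none (Interval? {n} a 0) λ { _ (_ , ()) }) (sym (0∸n≡0 a))
count-interval {suc n} zero    (suc e) (s≤s e≤n) = cong suc (count-interval-tail 0 e e≤n)
count-interval {suc n} (suc a) (suc e) (s≤s e≤n) = count-interval-tail (suc a) e e≤n

count-interval-tail {n} a e e≤n = begin
  length (filter shifted (tabulate F.suc)) ≡⟨ count-tail shifted ⟩
  count (shifted ∘ F.suc)                  ≡⟨ count-cong (shifted ∘ F.suc) (Interval? (pred a) e) (interval-shift a) ⟩
  count (Interval? {n} (pred a) e)         ≡⟨ count-interval (pred a) e e≤n ⟩
  e ∸ pred a                               ∎
  where
  open ≡-Reasoning
  shifted : Decidable (Interval {suc n} a (suc e))
  shifted = Interval? a (suc e)

steps⇒strictlyIncreasing : ∀ {m} (x : Fin (suc m) → ℕ) → (∀ i → x (inject₁ i) < x (F.suc i)) →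
                           ∀ {a b} → a F.< b → x a < x b
steps⇒strictlyIncreasing x step {F.zero} {F.suc F.zero} _ = step F.zero
steps⇒strictlyIncreasing {suc m} x step {F.zero} {F.suc (F.suc b)} _ =
  <-trans (step F.zero) (steps⇒strictlyIncreasing (x ∘ F.suc) (step ∘ F.suc) {F.zero} {F.suc b} (s≤s z≤n))
steps⇒strictlyIncreasing {suc m} x step {F.suc a} {F.suc b} (s≤s a<b) =
  steps⇒strictlyIncreasing (x ∘ F.suc) (step ∘ F.suc) a<b

strictlyIncreasing-reflects : ∀ {m} (x : Fin m → ℕ) → (∀ {a b} → a F.< b → x a < x b) →
                              ∀ {a b} → x a < x b → a F.< b
strictlyIncreasing-reflects x mono {a} {b} xa<xb with <-cmp (toℕ a) (toℕ b)
... | tri< a<b _ _ = a<b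
... | tri≈ _ a≡b _ = contradiction (subst (λ c → x a < x c) (sym (toℕ-injective a≡b)) xa<xb) (<-irrefl refl)
... | tri> _ _ b<a = contradiction (mono b<a) (<-asym xa<xb)

Ascending₄ : (Fin 4 → ℕ) → Set
Ascending₄ x = x (# 0) < x (# 1) × x (# 1) < x (# 2) × x (# 2) < x (# 3)

ascending₄⇒strictlyIncreasing : ∀ {x} → Ascending₄ x → ∀ {a b} → a F.< b → x a < x b
ascending₄⇒strictlyIncreasing {x} (x₀<x₁ , x₁<x₂ , x₂<x₃) = steps⇒strictlyIncreasing x λ
  { F.zero → x₀<x₁ ; (F.suc F.zero) → x₁<x₂ ; (F.suc (F.suc F.zero)) → x₂<x₃ }

-- σ r is the position of the (r + 1)-st smallest letter of p, i.e. σ is p⁻¹ (0-based). The inverses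
-- 2413, 3214, 4132, 4213 of the four patterns are the evil patterns.
record InversePattern (p : Pattern4) : Set where
  field
    σ      : Fin 4 → Fin 4
    p∘σ    : ∀ r → p (σ r) ≡ suc (toℕ r)
    σ-onto : ∀ a → ∃ λ r → σ r ≡ a

module _ {n} (w : Permutation′ n) {p : Pattern4} (p⁻¹ : InversePattern p) where
  open InversePattern p⁻¹

  Occurrence : Set
  Occurrence = Σ (Fin 4 → Fin n) λ q → Ascending₄ (toℕ ∘ q) × Ascending₄ (val w ∘ q ∘ σ)

  rank-< : ∀ {r s} → r F.< s → p (σ r) < p (σ s)
  rank-< {r} {s} r<s = subst₂ _<_ (sym (p∘σ r)) (sym (p∘σ s)) (s≤s r<s)

  contains⇔occurrence : Contains w p ⇔ Occurrence
  contains⇔occurrence = mk⇔ to from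
    where
    to : Contains w p → Occurrence
    to (q , mono , iso) = q , (mono _ _ (s≤s z≤n) , mono _ _ (s≤s (s≤s z≤n)) , mono _ _ (s≤s (s≤s (s≤s z≤n))))
                           , (ord (s≤s z≤n) , ord (s≤s (s≤s z≤n)) , ord (s≤s (s≤s (s≤s z≤n))))
      where
      ord : ∀ {r s} → r F.< s → val w (q (σ r)) < val w (q (σ s))
      ord r<s = Equivalence.to (iso _ _) (rank-< r<s)
    from : Occurrence → Contains w p
    from (q , positions , values) = q , (λ _ _ → ascending₄⇒strictlyIncreasing positions) , iso
      where
      iso : ∀ a b → (p a < p b) ⇔ (val w (q a) < val w (q b))
      iso a b with σ-onto a | σ-onto b
      ... | r , refl | s , refl = mk⇔
        (λ pa<pb → ascending₄⇒strictlyIncreasing values (≤-pred (subst₂ _<_ (p∘σ r) (p∘σ s) pa<pb)))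
        (λ va<vb → rank-< (strictlyIncreasing-reflects (val w ∘ q ∘ σ) (ascending₄⇒strictlyIncreasing values) va<vb))

inversePattern : ∀ p (σ : Vec (Fin 4) 4) →
                 {_ : True (all? λ r → p (lookup σ r) ≟ suc (toℕ r))} →
                 {_ : True (all? λ a → any? λ r → lookup σ r F.≟ a)} → InversePattern p
inversePattern p σ {ranked} {onto} = record
  { σ = lookup σ ; p∘σ = toWitness ranked ; σ-onto = toWitness onto }

p3142⁻¹ : InversePattern p3142
p3142⁻¹ = inversePattern p3142 (# 1 ∷ # 3 ∷ # 0 ∷ # 2 ∷ [])

p3214⁻¹ : InversePattern p3214
p3214⁻¹ = inversePattern p3214 (# 2 ∷ # 1 ∷ # 0 ∷ # 3 ∷ [])

p2431⁻¹ : InversePattern p2431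
p2431⁻¹ = inversePattern p2431 (# 3 ∷ # 0 ∷ # 2 ∷ # 1 ∷ [])

p3241⁻¹ : InversePattern p3241
p3241⁻¹ = inversePattern p3241 (# 3 ∷ # 1 ∷ # 0 ∷ # 2 ∷ [])

≡suc⇒< : ∀ {x y} → y ≡ suc x → x < y
≡suc⇒< refl = ≤-refl

maximal-above : ∀ {n} {P : Pred (Fin n) ℓ} → Decidable P → ∀ {i} → P i →
                ∃ λ m → i F.≤ m × P m × (∀ k → m F.< k → ¬ P k)
maximal-above {P = P} P? {i} pi = go i (>-wellFounded i) ≤-refl pi
  where
  go : ∀ m → Acc F._>_ m → i F.≤ m → P m → ∃ λ m → i F.≤ m × P m × (∀ k → m F.< k → ¬ P k)
  go m (acc rec) i≤m pm with any? (λ k → (toℕ m <? toℕ k) ×-dec P? k)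
  ... | yes (k , m<k , pk) = go k (rec m<k) (≤-trans i≤m (<⇒≤ m<k)) pk
  ... | no ¬bigger         = m , i≤m , pm , λ k m<k pk → ¬bigger (k , m<k , pk)

AvoidsAll : ∀ {n} → Permutation′ n → Set
AvoidsAll w = Avoids w p3142 × Avoids w p3214 × Avoids w p2431 × Avoids w p3241

module _ {n} (w : Permutation′ n) where

  private
    v : Fin n → ℕ
    v = val w

  val-injective : ∀ {i j} → v i ≡ v j → i ≡ j
  val-injective = Injection.injective (↔⇒↣ w) ∘ toℕ-injective

  val-<-or-> : ∀ {i j} → toℕ i < toℕ j → v i < v j ⊎ v j < v i
  val-<-or-> {i} {j} i<j with <-cmp (v i) (v j)
  ... | tri< vi<vj _ _ = inj₁ vi<vj
  ... | tri≈ _ vi≡vj _ = contradiction (cong toℕ (val-injective vi≡vj)) (<⇒≢ i<j)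
  ... | tri> _ _ vj<vi = inj₂ vj<vi

  toℕ-<-or-> : ∀ {i j} → v i < v j → toℕ i < toℕ j ⊎ toℕ j < toℕ i
  toℕ-<-or-> {i} {j} vi<vj with <-cmp (toℕ i) (toℕ j)
  ... | tri< i<j _ _ = inj₁ i<j
  ... | tri≈ _ i≡j _ = contradiction (cong v (toℕ-injective i≡j)) (<⇒≢ vi<vj)
  ... | tri> _ _ j<i = inj₂ j<i

  successor : ∀ {i l : Fin n} → toℕ i < toℕ l → ∃ λ (i′ : Fin n) → toℕ i′ ≡ suc (toℕ i)
  successor {l = l} i<l = fromℕ< (≤-<-trans i<l (toℕ<n l)) , toℕ-fromℕ< _

  embed : ∀ {p} (p⁻¹ : InversePattern p) (q : Vec (Fin n) 4) →
          Ascending₄ (toℕ ∘ lookup q) → Ascending₄ (v ∘ lookup q ∘ InversePattern.σ p⁻¹) → Contains w p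
  embed p⁻¹ q positions values = Equivalence.from (contains⇔occurrence w p⁻¹) (lookup q , positions , values)

  Inversion : Fin n → Fin n → Set
  Inversion i j = toℕ i < toℕ j × v j < v i

  inversion? : ∀ i → Decidable (Inversion i)
  inversion? i j = (toℕ i <? toℕ j) ×-dec (v j <? v i)

  lehmer-pos : ∀ {i j} → Inversion i j → 0 < lehmer w i
  lehmer-pos = count-pos (inversion? _)

  lehmer-pos⇒inversion : ∀ {i} → 0 < lehmer w i → ∃ (Inversion i)
  lehmer-pos⇒inversion = count-pos⇒∃ (inversion? _)

  IncreasingOn : Fin n → Fin n → Set
  IncreasingOn b j = ∀ (k l : Fin n) → toℕ b ≤ toℕ k → toℕ k < toℕ l → toℕ l ≤ toℕ j → v k < v l

  increasingOn-refl : ∀ b → IncreasingOn b b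
  increasingOn-refl b k l b≤k k<l l≤b = contradiction (≤-trans l≤b b≤k) (<⇒≱ k<l)

  increasingOn-suffix : ∀ {b b′ j} → toℕ b ≤ toℕ b′ → IncreasingOn b j → IncreasingOn b′ j
  increasingOn-suffix b≤b′ run k l b′≤k = run k l (≤-trans b≤b′ b′≤k)

  increasingOn-minimum : ∀ {b j k} → IncreasingOn b j → toℕ b ≤ toℕ k → toℕ k ≤ toℕ j → v b ≤ v k
  increasingOn-minimum {b} {j} {k} run b≤k k≤j with m≤n⇒m<n∨m≡n b≤k
  ... | inj₁ b<k = <⇒≤ (run b k ≤-refl b<k k≤j)
  ... | inj₂ b≡k = ≤-reflexive (cong v (toℕ-injective b≡k))

  increasingOn-extend : ∀ {b i i′} → IncreasingOn b i → toℕ i′ ≡ suc (toℕ i) → v i < v i′ →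
                        IncreasingOn b i′
  increasingOn-extend {b} {i} {i′} run i′≡1+i vi<vi′ k l b≤k k<l l≤i′ with m≤n⇒m<n∨m≡n l≤i′
  ... | inj₁ l<i′ = run k l b≤k k<l (≤-pred (subst (toℕ l <_) i′≡1+i l<i′))
  ... | inj₂ l≡i′ rewrite toℕ-injective l≡i′ =
    ≤-<-trans (increasingOn-minimum (increasingOn-suffix b≤k run) k≤i ≤-refl) vi<vi′
    where
    k≤i : toℕ k ≤ toℕ i
    k≤i = ≤-pred (subst (toℕ k <_) i′≡1+i k<l)

  inversion-beyond-run : ∀ {b j i k} → IncreasingOn b j → toℕ b ≤ toℕ i → Inversion i k → toℕ j < toℕ k
  inversion-beyond-run {j = j} {i} {k} run b≤i (i<k , vk<vi) with toℕ k ≤? toℕ j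
  ... | yes k≤j = contradiction (run i k b≤i i<k k≤j) (<-asym vk<vi)
  ... | no k≰j  = ≰⇒> k≰j

  record RunEnd (p : Fin n) : Set where
    constructor mkRunEnd
    field
      j j′       : Fin n
      j′≡1+j     : toℕ j′ ≡ suc (toℕ j)
      descent    : v j′ < v j
      start≤j    : toℕ p ≤ toℕ j
      increasing : IncreasingOn p j

  inversion⇒runEnd : ∀ {p l} → toℕ p < toℕ l → v l < v p → RunEnd p
  inversion⇒runEnd {p} {l} p<l vl<vp = go p (>-wellFounded p) ≤-refl (increasingOn-refl p) p<l
    where
    go : ∀ i → Acc F._>_ i → toℕ p ≤ toℕ i → IncreasingOn p i → toℕ i < toℕ l → RunEnd p
    go i (acc rec) p≤i run i<l with successor i<l
    ... | i′ , i′≡1+i with val-<-or-> (≡suc⇒< i′≡1+i)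
    ... | inj₂ vi′<vi = mkRunEnd i i′ i′≡1+i vi′<vi p≤i run
    ... | inj₁ vi<vi′ = go i′ (rec (≡suc⇒< i′≡1+i)) p≤i′ run′ i′<l
      where
      p≤i′ : toℕ p ≤ toℕ i′
      p≤i′ = ≤-trans p≤i (<⇒≤ (≡suc⇒< i′≡1+i))
      run′ : IncreasingOn p i′
      run′ = increasingOn-extend run i′≡1+i vi<vi′
      i′<l : toℕ i′ < toℕ l
      i′<l with m≤n⇒m<n∨m≡n (subst (_≤ toℕ l) (sym i′≡1+i) i<l)
      ... | inj₁ i′<l = i′<l
      ... | inj₂ i′≡l = contradiction (subst (λ x → v p ≤ v x) (toℕ-injective i′≡l)
                          (increasingOn-minimum run′ p≤i′ ≤-refl)) (<⇒≱ vl<vp)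

  lehmer<⇔larger-later : ∀ {b j} → toℕ b ≤ toℕ j → IncreasingOn b j →
                         lehmer w b < n ∸ suc (toℕ j) ⇔ (∃ λ t → toℕ j < toℕ t × v b < v t)
  lehmer<⇔larger-later {b} {j} b≤j run = mk⇔ to from
    where
    later : Decidable (Interval (suc (toℕ j)) n)
    later = Interval? (suc (toℕ j)) n
    to : lehmer w b < n ∸ suc (toℕ j) → ∃ λ t → toℕ j < toℕ t × v b < v t
    to c<N with any? (λ t → (toℕ j <? toℕ t) ×-dec (v b <? v t))
    ... | yes larger = larger
    ... | no ¬larger = contradiction
      (subst (_≤ lehmer w b) (count-interval _ n ≤-refl) (count-mono later (inversion? b) later⊆inversion))
      (<⇒≱ c<N)
      where
      later⊆inversion : Interval (suc (toℕ j)) n ⊆ Inversion b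
      later⊆inversion {t} (j<t , _) with val-<-or-> (≤-<-trans b≤j j<t)
      ... | inj₁ vb<vt = contradiction (t , j<t , vb<vt) ¬larger
      ... | inj₂ vt<vb = ≤-<-trans b≤j j<t , vt<vb
    from : (∃ λ t → toℕ j < toℕ t × v b < v t) → lehmer w b < n ∸ suc (toℕ j)
    from (t , j<t , vb<vt) = subst (lehmer w b <_) (count-interval _ n ≤-refl)
      (count-mono-< (inversion? b) later (λ {i} inv → inversion-beyond-run run ≤-refl inv , toℕ<n i)
                    (j<t , toℕ<n t) (λ (_ , vt<vb) → <-asym vt<vb vb<vt))

  larger-in-window⇒later-inversion : ∀ {b j k} → IncreasingOn b j →
    toℕ j < toℕ k → toℕ k ≤ toℕ j + lehmer w b → v b < v k → ∃ λ s → toℕ k < toℕ s × v s < v b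
  larger-in-window⇒later-inversion {b} {j} {k} run j<k k≤j+c vb<vk
    with any? (λ s → (toℕ k <? toℕ s) ×-dec (v s <? v b))
  ... | yes later = later
  ... | no ¬later = contradiction
    (subst (lehmer w b ≤_) (count-interval _ _ (<⇒≤ (toℕ<n k)))
           (count-mono (inversion? b) (Interval? (suc (toℕ j)) (toℕ k)) inversion⊆before-k))
    (<⇒≱ window-short)
    where
    inversion⊆before-k : Inversion b ⊆ Interval (suc (toℕ j)) (toℕ k)
    inversion⊆before-k {i} inv@(_ , vi<vb) with toℕ-<-or-> (<-trans vi<vb vb<vk)
    ... | inj₁ i<k = inversion-beyond-run run ≤-refl inv , i<k
    ... | inj₂ k<i = contradiction (i , k<i , vi<vb) ¬later
    window-short : toℕ k ∸ suc (toℕ j) < lehmer w b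
    window-short = subst (toℕ k ∸ suc (toℕ j) <_) (m+n∸m≡n (toℕ j) (lehmer w b)) (∸-monoˡ-< (s≤s k≤j+c) j<k)

  -- The window has c_b positions; if all were inversions of b, s would be one more.
  distant-inversion⇒larger-in-window : ∀ {b j s} → toℕ b ≤ toℕ j → IncreasingOn b j →
    toℕ j + lehmer w b < toℕ s → v s < v b →
    ∃ λ k → toℕ j < toℕ k × toℕ k ≤ toℕ j + lehmer w b × v b < v k
  distant-inversion⇒larger-in-window {b} {j} {s} b≤j run j+c<s vs<vb
    with any? (λ k → (toℕ j <? toℕ k) ×-dec ((toℕ k ≤? toℕ j + lehmer w b) ×-dec (v b <? v k)))
  ... | yes larger = larger
  ... | no ¬larger = contradiction
    (count-mono-< window (inversion? b) window⊆inversion (b<s , vs<vb) (λ (_ , s≤j+c) → <⇒≱ j+c<s (≤-pred s≤j+c)))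
    (≤⇒≯ (≤-reflexive (sym window-size)))
    where
    window : Decidable (Interval (suc (toℕ j)) (suc (toℕ j + lehmer w b)))
    window = Interval? (suc (toℕ j)) (suc (toℕ j + lehmer w b))
    b<s : toℕ b < toℕ s
    b<s = ≤-<-trans (≤-trans b≤j (m≤m+n _ _)) j+c<s
    window⊆inversion : Interval (suc (toℕ j)) (suc (toℕ j + lehmer w b)) ⊆ Inversion b
    window⊆inversion {k} (j<k , k≤j+c) with val-<-or-> (≤-<-trans b≤j j<k)
    ... | inj₁ vb<vk = contradiction (k , j<k , ≤-pred k≤j+c , vb<vk) ¬larger
    ... | inj₂ vk<vb = ≤-<-trans b≤j j<k , vk<vb
    window-size : count window ≡ lehmer w b
    window-size = trans (count-interval _ _ (<-trans j+c<s (toℕ<n s))) (m+n∸m≡n (toℕ j) (lehmer w b))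

  maximal-candidate : ∀ {p z} (r : RunEnd p) → let open RunEnd r in
    lehmer w p < n ∸ suc (toℕ j) → toℕ j < toℕ z → v z < v p →
    ∃ λ b → toℕ p ≤ toℕ b × Candidate w j b × (∀ b′ → toℕ b < toℕ b′ → ¬ Candidate w j b′)
  maximal-candidate {p} {z} (mkRunEnd j _ _ _ p≤j run) cp<N j<z vz<vp
    with maximal-above Closer? (p≤j , cp<N)
    where
    Closer? : Decidable (λ b → toℕ b ≤ toℕ j × lehmer w b < n ∸ suc (toℕ j))
    Closer? b = (toℕ b ≤? toℕ j) ×-dec (lehmer w b <? n ∸ suc (toℕ j))
  ... | b , p≤b , (b≤j , cb<N) , maximal =
    b , p≤b , candidate , λ b′ b<b′ (b′≤j , _ , _ , cb′<N) → maximal b′ b<b′ (b′≤j , cb′<N)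
    where
    candidate : Candidate w j b
    candidate = b≤j , increasingOn-suffix p≤b run
              , lehmer-pos (≤-<-trans b≤j j<z , <-≤-trans vz<vp (increasingOn-minimum run p≤b b≤j)) , cb<N

  lehmerCondition-excludes : LehmerCondition w → ∀ {p h y z} (r : RunEnd p) → let open RunEnd r in
    toℕ j < toℕ h → v p < v h → toℕ j < toℕ y → toℕ y < toℕ z → v z < v y → v z < v p → ⊥
  lehmerCondition-excludes lc {p} {h} {y} {z} r@(mkRunEnd j j′ j′≡1+j descent p≤j run)
                           j<h vp<vh j<y y<z vz<vy vz<vp
    with maximal-candidate r (Equivalence.from (lehmer<⇔larger-later p≤j run) (h , j<h , vp<vh))
                           (<-trans j<y y<z) vz<vp
  ... | b , p≤b , candidate@(b≤j , runᵇ , _ , _) , maximal =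
    let k , j<k , k≤j+c , 0<cₖ = positive-in-window in >⇒≢ 0<cₖ (zero-in-window k j<k k≤j+c)
    where
    zero-in-window : ∀ k → toℕ j < toℕ k → toℕ k ≤ toℕ j + lehmer w b → lehmer w k ≡ 0
    zero-in-window = lc j j′ j′≡1+j descent b candidate maximal
    vz<vb : v z < v b
    vz<vb = <-≤-trans vz<vp (increasingOn-minimum run p≤b b≤j)
    positive-in-window : ∃ λ k → toℕ j < toℕ k × toℕ k ≤ toℕ j + lehmer w b × 0 < lehmer w k
    positive-in-window with toℕ y ≤? toℕ j + lehmer w b
    ... | yes y≤j+c = y , j<y , y≤j+c , lehmer-pos (y<z , vz<vy)
    ... | no y≰j+c with distant-inversion⇒larger-in-window b≤j runᵇ (<-trans (≰⇒> y≰j+c) y<z) vz<vb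
    ...   | k , j<k , k≤j+c , vb<vk =
      k , j<k , k≤j+c , lehmer-pos (<-trans (≤-<-trans k≤j+c (≰⇒> y≰j+c)) y<z , <-trans vz<vb vb<vk)

  lehmerCondition⇒avoidsAll : LehmerCondition w → AvoidsAll w
  lehmerCondition⇒avoidsAll lc = avoids3142 , avoids3214 , avoids2431 , avoids3241
    where
    occurrence : ∀ {p} (p⁻¹ : InversePattern p) → Contains w p → Occurrence w p⁻¹
    occurrence p⁻¹ = Equivalence.to (contains⇔occurrence w p⁻¹)

    beyond-run : ∀ {p} (r : RunEnd p) {i k} → toℕ p ≤ toℕ i → Inversion i k → toℕ (RunEnd.j r) < toℕ k
    beyond-run r = inversion-beyond-run (RunEnd.increasing r)

    avoids3142 : Avoids w p3142
    avoids3142 c with occurrence p3142⁻¹ c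
    ... | q , (q₀<q₁ , q₁<q₂ , q₂<q₃) , (v₁<v₃ , v₃<v₀ , v₀<v₂) =
      lehmerCondition-excludes lc r j<q₂ v₀<v₂ j<q₂ q₂<q₃ (<-trans v₃<v₀ v₀<v₂) v₃<v₀
      where
      r : RunEnd (q (# 0))
      r = inversion⇒runEnd q₀<q₁ (<-trans v₁<v₃ v₃<v₀)
      j<q₂ : toℕ (RunEnd.j r) < toℕ (q (# 2))
      j<q₂ = <-trans (beyond-run r ≤-refl (q₀<q₁ , <-trans v₁<v₃ v₃<v₀)) q₁<q₂

    avoids3214 : Avoids w p3214
    avoids3214 c with occurrence p3214⁻¹ c
    ... | q , (q₀<q₁ , q₁<q₂ , q₂<q₃) , (v₂<v₁ , v₁<v₀ , v₀<v₃) =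
      lehmerCondition-excludes lc r (<-trans (<-trans j<q₁ q₁<q₂) q₂<q₃) v₀<v₃
                               j<q₁ q₁<q₂ v₂<v₁ (<-trans v₂<v₁ v₁<v₀)
      where
      r : RunEnd (q (# 0))
      r = inversion⇒runEnd q₀<q₁ v₁<v₀
      j<q₁ : toℕ (RunEnd.j r) < toℕ (q (# 1))
      j<q₁ = beyond-run r ≤-refl (q₀<q₁ , v₁<v₀)

    avoids2431 : Avoids w p2431
    avoids2431 c with occurrence p2431⁻¹ c
    ... | q , (q₀<q₁ , q₁<q₂ , q₂<q₃) , (v₃<v₀ , v₀<v₂ , v₂<v₁) =
      lehmerCondition-excludes lc r j<q₂ v₀<v₂ j<q₂ q₂<q₃ (<-trans v₃<v₀ v₀<v₂) v₃<v₀
      where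
      r : RunEnd (q (# 0))
      r = inversion⇒runEnd (<-trans (<-trans q₀<q₁ q₁<q₂) q₂<q₃) v₃<v₀
      j<q₂ : toℕ (RunEnd.j r) < toℕ (q (# 2))
      j<q₂ = beyond-run r (<⇒≤ q₀<q₁) (q₁<q₂ , v₂<v₁)

    avoids3241 : Avoids w p3241
    avoids3241 c with occurrence p3241⁻¹ c
    ... | q , (q₀<q₁ , q₁<q₂ , q₂<q₃) , (v₃<v₁ , v₁<v₀ , v₀<v₂) =
      lehmerCondition-excludes lc r (<-trans j<q₁ q₁<q₂) v₀<v₂
                               j<q₁ (<-trans q₁<q₂ q₂<q₃) v₃<v₁ (<-trans v₃<v₁ v₁<v₀)
      where
      r : RunEnd (q (# 0))
      r = inversion⇒runEnd q₀<q₁ v₁<v₀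
      j<q₁ : toℕ (RunEnd.j r) < toℕ (q (# 1))
      j<q₁ = beyond-run r ≤-refl (q₀<q₁ , v₁<v₀)

  descent-above-below : AvoidsAll w → ∀ {j j′ x y} → toℕ j′ ≡ suc (toℕ j) → v j′ < v j →
    toℕ j < toℕ x → toℕ x < toℕ y → v j < v x → v y < v j → ⊥
  descent-above-below (avoid3142 , _ , _ , avoid3241) {j} {j′} {x} {y} j′≡1+j vj′<vj j<x x<y vj<vx vy<vj
    with m≤n⇒m<n∨m≡n (subst (_≤ toℕ x) (sym j′≡1+j) j<x)
  ... | inj₂ j′≡x = contradiction (subst (λ i → v i < v j) (toℕ-injective j′≡x) vj′<vj) (<-asym vj<vx)
  ... | inj₁ j′<x with val-<-or-> (<-trans j′<x x<y)
  ...   | inj₁ vj′<vy = avoid3142 (embed p3142⁻¹ (j ∷ j′ ∷ x ∷ y ∷ [])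
                                  (≡suc⇒< j′≡1+j , j′<x , x<y) (vj′<vy , vy<vj , vj<vx))
  ...   | inj₂ vy<vj′ = avoid3241 (embed p3241⁻¹ (j ∷ j′ ∷ x ∷ y ∷ [])
                                  (≡suc⇒< j′≡1+j , j′<x , x<y) (vy<vj′ , vj′<vj , vj<vx))

  window-above : AvoidsAll w → ∀ {j j′ b k s} → toℕ j′ ≡ suc (toℕ j) → v j′ < v j →
    toℕ b ≤ toℕ j → IncreasingOn b j → toℕ j < toℕ k → v b < v k → toℕ k < toℕ s → v s < v b → ⊥
  window-above avoid@(_ , _ , avoid2431 , _) {j} {j′} {b} {k} {s} j′≡1+j vj′<vj b≤j run j<k vb<vk k<s vs<vb
    with val-<-or-> j<k
  ... | inj₁ vj<vk = descent-above-below avoid j′≡1+j vj′<vj j<k k<s vj<vk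
                       (<-≤-trans vs<vb (increasingOn-minimum run b≤j ≤-refl))
  ... | inj₂ vk<vj with m≤n⇒m<n∨m≡n b≤j
  ...   | inj₁ b<j = avoid2431 (embed p2431⁻¹ (b ∷ j ∷ k ∷ s ∷ []) (b<j , j<k , k<s) (vs<vb , vb<vk , vk<vj))
  ...   | inj₂ b≡j = contradiction (subst (λ i → v k < v i) (sym (toℕ-injective b≡j)) vk<vj) (<-asym vb<vk)

  window-below : AvoidsAll w → ∀ {j j′ b k m t} → toℕ j′ ≡ suc (toℕ j) → v j′ < v j → toℕ b ≤ toℕ j →
    toℕ j < toℕ k → v k < v b → toℕ k < toℕ m → v m < v k → toℕ j < toℕ t → v b < v t →
    (toℕ b < toℕ j → v t < v j) → ⊥
  window-below avoid@(_ , avoid3214 , avoid2431 , avoid3241) {j} {j′} {b} {k} {m} {t}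
               j′≡1+j vj′<vj b≤j j<k vk<vb k<m vm<vk j<t vb<vt below-top
    with toℕ-<-or-> (<-trans (<-trans vm<vk vk<vb) vb<vt)
  ... | inj₁ m<t = avoid3214 (embed p3214⁻¹ (b ∷ k ∷ m ∷ t ∷ []) (≤-<-trans b≤j j<k , k<m , m<t) (vm<vk , vk<vb , vb<vt))
  ... | inj₂ t<m with m≤n⇒m<n∨m≡n b≤j
  ...   | inj₁ b<j = avoid2431 (embed p2431⁻¹ (b ∷ j ∷ t ∷ m ∷ []) (b<j , j<t , t<m) (<-trans vm<vk vk<vb , vb<vt , below-top b<j))
  ...   | inj₂ b≡j with toℕ-injective b≡j
  ...     | refl with toℕ-<-or-> (<-trans vk<vb vb<vt)
  ...       | inj₁ k<t = avoid3241 (embed p3241⁻¹ (b ∷ k ∷ t ∷ m ∷ []) (j<k , k<t , t<m) (vm<vk , vk<vb , vb<vt))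
  ...       | inj₂ t<k = descent-above-below avoid j′≡1+j vj′<vj j<t t<m vb<vt (<-trans vm<vk vk<vb)

  -- m makes c_{b+1} positive, so by maximality c_{b+1} ≥ n - j - 1: no value after j exceeds w_{b+1}.
  maximal-candidate⇒below-top : ∀ {j b m t} → IncreasingOn b j → toℕ b < toℕ j →
    (∀ b′ → toℕ b < toℕ b′ → ¬ Candidate w j b′) →
    toℕ j < toℕ m → v m < v b → toℕ j < toℕ t → v t < v j
  maximal-candidate⇒below-top {j} {b} {m} {t} run b<j maximal j<m vm<vb j<t =
    let b′ , b′≡1+b = successor b<j in below-top b′ b′≡1+b
    where
    below-top : ∀ b′ → toℕ b′ ≡ suc (toℕ b) → v t < v j
    below-top b′ b′≡1+b = [ (λ vb′<vt → contradiction (candidate vb′<vt) (maximal b′ b<b′))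
                          , (λ vt<vb′ → <-≤-trans vt<vb′ (increasingOn-minimum run′ b′≤j ≤-refl))
                          ]′ (val-<-or-> (≤-<-trans b′≤j j<t))
      where
      b<b′ : toℕ b < toℕ b′
      b<b′ = ≡suc⇒< b′≡1+b
      b′≤j : toℕ b′ ≤ toℕ j
      b′≤j = subst (_≤ toℕ j) (sym b′≡1+b) b<j
      run′ : IncreasingOn b′ j
      run′ = increasingOn-suffix (<⇒≤ b<b′) run
      candidate : v b′ < v t → Candidate w j b′
      candidate vb′<vt = b′≤j , run′
        , lehmer-pos (≤-<-trans b′≤j j<m , <-trans vm<vb (run b b′ ≤-refl b<b′ b′≤j))
        , Equivalence.from (lehmer<⇔larger-later b′≤j run′) (t , j<t , vb′<vt)

  avoidsAll⇒lehmerCondition : AvoidsAll w → LehmerCondition w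
  avoidsAll⇒lehmerCondition avoid j j′ j′≡1+j vj′<vj b (b≤j , run , _ , cb<N) maximal k j<k k≤j+c
    with lehmer w k ≟ 0
  ... | yes cₖ≡0 = cₖ≡0
  ... | no cₖ≢0 with lehmer-pos⇒inversion (n≢0⇒n>0 cₖ≢0) | val-<-or-> (≤-<-trans b≤j j<k)
  ...   | m , k<m , vm<vk | inj₁ vb<vk =
    let s , k<s , vs<vb = larger-in-window⇒later-inversion run j<k k≤j+c vb<vk
    in ⊥-elim (window-above avoid j′≡1+j vj′<vj b≤j run j<k vb<vk k<s vs<vb)
  ...   | m , k<m , vm<vk | inj₂ vk<vb =
    let t , j<t , vb<vt = Equivalence.to (lehmer<⇔larger-later b≤j run) cb<N
    in ⊥-elim (window-below avoid j′≡1+j vj′<vj b≤j j<k vk<vb k<m vm<vk j<t vb<vt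
                 (λ b<j → maximal-candidate⇒below-top run b<j maximal (<-trans j<k k<m) (<-trans vm<vk vk<vb) j<t))

proposition3p2 : ∀ (n : ℕ) (w : Permutation′ n) →
    (Avoids w p3142 × Avoids w p3214 × Avoids w p2431 × Avoids w p3241) ⇔ LehmerCondition w
proposition3p2 n w = mk⇔ (avoidsAll⇒lehmerCondition w) (lehmerCondition⇒avoidsAll w)
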